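{- Let $q$ be a prime power, $n,r$ positive integers, and let $U_1,\ldots,U_r$ be $\mathbb{F}_q$-subspaces of $\mathbb{F}_{q^n}$ of dimensions $k_1,\ldots,k_r$. Let $U=U_1\times\cdots\times U_r$. If $\{U_1,\ldots,U_r\}$ is a multi-Sidon space, then $L_U$ is an $\mathbb{F}_q$-linear set of rank $k_1+\cdots+k_r$ in $\mathrm{PG}(r-1,q^n)$ such that the only points of weight greater than one are the points $P_i=\langle\mathbf{e}_i\rangle_{\mathbb{F}_{q^n}}$, $i\in\{1,\ldots,r\}$.
   Context: $\mathbf{e}_i$ is the $i$-th standard basis vector of $\mathbb{F}_{q^n}^r$. For an $\mathbb{F}_q$-subspace $W$ of $\mathbb{F}_{q^n}^r$, $L_W=\{\langle\mathbf{w}\rangle_{\mathbb{F}_{q^n}}:\mathbf{w}\in W\setminus\{\mathbf{0}\}\}$ has rank $\dim_{\mathbb{F}_q}W$, and $w_{L_W}(\langle\mathbf{v}\rangle_{\mathbb{F}_{q^n}})=\dim_{\mathbb{F}_q}(W\cap\langle\mathbf{v}\rangle_{\mathbb{F}_{q^n}})$. $\mathrm{Orb}(U)=\{\alpha U:\alpha\in\mathbb{F}_{q^n}^*\}$. A set $\{U_1,\ldots,U_r\}$ of $\mathbb{F}_q$-subspaces of $\mathbb{F}_{q^n}$ is a multi-Sidon space if: $\mathrm{Orb}(U_i)\cap\mathrm{Orb}(U_j)=\emptyset$ for $i\neq j$; $\dim_{\mathbb{F}_q}(U_i)\geq 2$ and $|\mathrm{Orb}(U_i)|=\frac{q^n-1}{q-1}$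 for all $i$; and $\dim_{\mathbb{F}_q}(U_i\cap\alpha U_j)\leq 1$ for every $\alpha\in\mathbb{F}_{q^n}$ and all $i,j$ with $U_i\neq\alpha U_j$. -}

module Defs where

open import Level using (Level; _⊔_)
open import Data.Nat as ℕ using (ℕ; _^_; _∸_; _≤_; _<_)
open import Data.Nat.Primality using (Prime)
open import Data.Fin using (Fin; _≟_)
open import Data.Vec using (Vec; lookup; zipWith; foldr)
open import Data.Product using (Σ; ∃; _×_; _,_)
open import Data.Sum using (_⊎_)
open import Relation.Nullary using (¬_; yes; no)
open import Relation.Binary.PropositionalEquality using (_≡_)
open import Algebra.Bundles using (CommutativeRing)

IsPrimePower : ℕ → Set
IsPrimePower q = ∃ λ p → ∃ λ k → Prime p × 1 ≤ k × q ≡ p ^ k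

module _ {a ℓ : Level} {A : Set a} (_≈_ : A → A → Set ℓ) where

  SameSet : {p : Level} → (A → Set p) → (A → Set p) → Set (a ⊔ p)
  SameSet P Q = ∀ x → (P x → Q x) × (Q x → P x)

  -- The subset P (closed under ≈ assumed elsewhere) has exactly m elements:
  -- a bijection Fin m → P modulo ≈.
  HasCard : {p : Level} → (A → Set p) → ℕ → Set (a ⊔ ℓ ⊔ p)
  HasCard P m = Σ (Fin m → A) λ f →
      (∀ i → P (f i))
    × (∀ i j → f i ≈ f j → i ≡ j)
    × (∀ x → P x → ∃ λ i → x ≈ f i)

record FieldD (c ℓ : Level) : Set (Level.suc (c ⊔ ℓ)) where
  field
    cring   : CommutativeRing c ℓ
  open CommutativeRing cring public
  field
    1≉0     : ¬ (1# ≈ 0#)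
    inverse : ∀ x → ¬ (x ≈ 0#) → ∃ λ y → (x * y) ≈ 1#

-- Everything below lives over a field F (playing the role of F_{q^n})
-- together with a subfield K ⊆ F (playing the role of F_q), given as a
-- predicate on the carrier of F.

module OverField {c ℓ : Level} (F : FieldD c ℓ) where
  open FieldD F public

  IsSubfield : (Carrier → Set ℓ) → Set (c ⊔ ℓ)
  IsSubfield K =
      (∀ {x y} → x ≈ y → K x → K y)
    × K 0# × K 1#
    × (∀ {x y} → K x → K y → K (x + y))
    × (∀ {x} → K x → K (- x))
    × (∀ {x y} → K x → K y → K (x * y))
    × (∀ {x} → K x → ¬ (x ≈ 0#) → ∃ λ y → K y × (x * y) ≈ 1#)

  Vecᶠ : ℕ → Set c
  Vecᶠ r = Fin r → Carrier

  module Space {v : Level} {V : Set v}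
           (_≈ᵥ_ : V → V → Set ℓ) (_+ᵥ_ : V → V → V) (0ᵥ : V)
           (_·_ : Carrier → V → V) (K : Carrier → Set ℓ) where

    lincomb : {k : ℕ} → Vec Carrier k → Vec V k → V
    lincomb cs vs = foldr (λ _ → V) _+ᵥ_ 0ᵥ (zipWith _·_ cs vs)

    InK : {k : ℕ} → Vec Carrier k → Set ℓ
    InK {k} cs = ∀ (j : Fin k) → K (lookup cs j)

    LinIndep : {k : ℕ} → Vec V k → Set (c ⊔ ℓ)
    LinIndep {k} vs = ∀ (cs : Vec Carrier k) → InK cs →
      lincomb cs vs ≈ᵥ 0ᵥ → ∀ j → lookup cs j ≈ 0#

    Spans : {k : ℕ} {p : Level} → (V → Set p) → Vec V k → Set (c ⊔ ℓ ⊔ v ⊔ p)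
    Spans {k} W vs = ∀ w → W w →
      ∃ λ (cs : Vec Carrier k) → InK cs × w ≈ᵥ lincomb cs vs

    HasDim : {p : Level} → (V → Set p) → ℕ → Set (c ⊔ ℓ ⊔ v ⊔ p)
    HasDim W k = ∃ λ (vs : Vec V k) →
      (∀ j → W (lookup vs j)) × LinIndep vs × Spans W vs

    IsSubspace : {p : Level} → (V → Set p) → Set (c ⊔ ℓ ⊔ v ⊔ p)
    IsSubspace W =
        (∀ {x y} → x ≈ᵥ y → W x → W y)
      × W 0ᵥ
      × (∀ {x y} → W x → W y → W (x +ᵥ y))
      × (∀ {a x} → K a → W x → W (a · x))

    -- the F-span ⟨ w ⟩ (an F-subspace, i.e. a projective point if w ≠ 0)
    Span : V → V → Set (c ⊔ ℓ)
    Span w x = ∃ λ α → x ≈ᵥ (α · w)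

  module OnF (K : Carrier → Set ℓ) = Space _≈_ _+_ 0# _*_ K

  module OnFr (r : ℕ) (K : Carrier → Set ℓ) =
    Space {V = Vecᶠ r} (λ x y → ∀ i → x i ≈ y i)
          (λ x y i → x i + y i) (λ _ → 0#) (λ α x i → α * x i) K

  scale : Carrier → (Carrier → Set (c ⊔ ℓ)) → Carrier → Set (c ⊔ ℓ)
  scale α U x = ∃ λ u → U u × x ≈ (α * u)

  _∩_ : {A : Set c} → (A → Set (c ⊔ ℓ)) → (A → Set (c ⊔ ℓ)) → A → Set (c ⊔ ℓ)
  (P ∩ Q) x = P x × Q x

  SameSetF : (Carrier → Set (c ⊔ ℓ)) → (Carrier → Set (c ⊔ ℓ)) → Set (c ⊔ ℓ)
  SameSetF = SameSet _≈_

  Nonzero : Carrier → Set ℓ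
  Nonzero α = ¬ (α ≈ 0#)

  -- |Orb(U)| = m : the set { α U : α ∈ F* } of subsets of F (subsets
  -- compared extensionally) has exactly m elements.
  OrbCard : (Carrier → Set (c ⊔ ℓ)) → ℕ → Set (c ⊔ ℓ)
  OrbCard U m = Σ (Fin m → Carrier) λ α →
      (∀ i → Nonzero (α i))
    × (∀ i j → SameSetF (scale (α i) U) (scale (α j) U) → i ≡ j)
    × (∀ β → Nonzero β → ∃ λ i → SameSetF (scale β U) (scale (α i) U))

  record MultiSidon (q n r : ℕ) (K : Carrier → Set ℓ)
                    (U : Fin r → Carrier → Set (c ⊔ ℓ)) : Set (c ⊔ ℓ) where
    open OnF K
    field
      orb-disjoint : ∀ i j → ¬ (i ≡ j) →
        ¬ (∃ λ α → ∃ λ β → Nonzero α × Nonzero β ×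
             SameSetF (scale α (U i)) (scale β (U j)))
      dim≥2        : ∀ i → ∃ λ k → HasDim (U i) k × 2 ≤ k
      -- |Orb(U_i)| = (q^n - 1)/(q - 1), written multiplicatively
      orb-full     : ∀ i → ∃ λ m → OrbCard (U i) m × m ℕ.* (q ∸ 1) ≡ q ^ n ∸ 1
      sidon        : ∀ α i j → ¬ SameSetF (U i) (scale α (U j)) →
        ∀ d → HasDim (U i ∩ scale α (U j)) d → d ≤ 1

  e : {r : ℕ} → Fin r → Vecᶠ r
  e i j with i ≟ j
  ... | yes _ = 1#
  ... | no  _ = 0#

  prodSpace : {r : ℕ} → (Fin r → Carrier → Set (c ⊔ ℓ)) → Vecᶠ r → Set (c ⊔ ℓ)
  prodSpace U x = ∀ i → U i (x i)

-- U = U₁ × ⋯ × Uᵣ has the concatenation of bases of the Uᵢ as a basis, and it meets the axis ⟨eᵢ⟩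
-- in a copy of Uᵢ, so Pᵢ has weight kᵢ ≥ 2. If v has two nonzero coordinates vᵢ, vⱼ, then w ↦ wᵢ
-- maps U ∩ ⟨v⟩ injectively and K-linearly into Uᵢ ∩ (vᵢ/vⱼ)Uⱼ; as Uᵢ and (vᵢ/vⱼ)Uⱼ lie in disjoint
-- orbits they differ, so the Sidon property bounds that dimension by one. A vector with a single
-- nonzero coordinate i spans Pᵢ. Finiteness of F and K makes membership in spans decidable, which lets
-- the image of a basis be greedily extended to a basis of Uᵢ ∩ (vᵢ/vⱼ)Uⱼ.

module Submission where

open import Defs
open import Level using (Level; _⊔_)
open import Data.Nat using (ℕ; _^_; _≤_; _<_; zero; suc)
open import Data.Nat.Properties using (≤-refl; ≤-trans; n≤1+n; <⇒≱)
open import Data.Fin using (Fin; zero; suc; _≟_)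
open import Data.Fin.Properties using (any?)
open import Data.Vec using (Vec; []; _∷_; sum; tabulate; lookup; map; replicate; _++_; splitAt)
open import Data.Vec.Properties using (lookup-replicate; lookup-map)
open import Data.Vec.Relation.Unary.All.Properties using (lookup⁺; lookup⁻; map⁺; ++⁺; ++ˡ⁻; ++ʳ⁻)
import Data.Vec.Functional as Vector
open import Data.List as List using (List)
open import Data.List.Membership.Propositional using (_∈_)
open import Data.List.Membership.Propositional.Properties using (∈-tabulate⁺)
open import Data.List.Relation.Unary.Any using (here; there)
open import Data.Product using (∃; Σ; _×_; _,_; proj₁; proj₂)
open import Data.Unit using (⊤; tt)
open import Data.Empty using (⊥-elim)
open import Function using (id)
open import Relation.Nullary using (¬_; Dec; yes; no)
open import Relation.Nullary.Decidable using (map′; _×-dec_; ¬?; decidable-stable)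
open import Relation.Unary using (_⊆_)
open import Relation.Binary.Definitions using (Decidable)
open import Relation.Binary.Bundles using (Setoid)
open import Relation.Binary.PropositionalEquality as ≡ using (_≡_)
import Algebra.Properties.Ring as RingProperties
import Algebra.Properties.Group as GroupProperties

any-Vec? : ∀ {p q} m {P : Vec (Fin q) m → Set p} → (∀ ds → Dec (P ds)) → Dec (∃ P)
any-Vec? zero    P? = map′ (λ p → [] , p) (λ { ([] , p) → p }) (P? [])
any-Vec? (suc m) P? = map′ (λ { (d , ds , p) → d ∷ ds , p }) (λ { (d ∷ ds , p) → d , ds , p })
  (any? λ d → any-Vec? m λ ds → P? (d ∷ ds))

module _ {a p} {A : Set a} (P : A → Set p) where
  ∀-++ : ∀ {m n} (xs : Vec A m) (ys : Vec A n) → (∀ i → P (lookup xs i)) → (∀ i → P (lookup ys i)) →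
    ∀ i → P (lookup (xs ++ ys) i)
  ∀-++ xs ys xs∈P ys∈P = lookup⁺ (++⁺ {P = P} {xs = xs} {ys} (lookup⁻ xs∈P) (lookup⁻ ys∈P))

  ∀-++ˡ : ∀ {m n} (xs : Vec A m) (ys : Vec A n) → (∀ i → P (lookup (xs ++ ys) i)) → ∀ i → P (lookup xs i)
  ∀-++ˡ xs ys xs++ys∈P = lookup⁺ (++ˡ⁻ {P = P} xs (lookup⁻ xs++ys∈P))

  ∀-++ʳ : ∀ {m n} (xs : Vec A m) (ys : Vec A n) → (∀ i → P (lookup (xs ++ ys) i)) → ∀ i → P (lookup ys i)
  ∀-++ʳ xs ys xs++ys∈P = lookup⁺ (++ʳ⁻ {P = P} xs (lookup⁻ xs++ys∈P))

  ∀-map : ∀ {b} {B : Set b} {m} (f : B → A) (xs : Vec B m) → (∀ i → P (f (lookup xs i))) →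
    ∀ i → P (lookup (map f xs) i)
  ∀-map f xs fxs∈P = lookup⁺ (map⁺ {P = P} {xs = xs} {f = f} (lookup⁻ fxs∈P))

module _ {a ℓ} (S : Setoid a ℓ) where
  open Setoid S

  finite⇒≈-decidable : ∀ {N} → HasCard _≈_ (λ _ → ⊤) N → Decidable _≈_
  finite⇒≈-decidable (f , _ , injective , surjective) x y with surjective x tt | surjective y tt
  ... | i , x≈fi | j , y≈fj with i ≟ j
  ...   | yes ≡.refl = yes (trans x≈fi (sym y≈fj))
  ...   | no  i≢j    = no λ x≈y → i≢j (injective i j (trans (sym x≈fi) (trans x≈y y≈fj)))

module _ {c ℓ : Level} (F : FieldD c ℓ) where
  open OverField F hiding (zero)
  open import Relation.Binary.Reasoning.Setoid setoid
  open RingProperties ring using (-‿distribˡ-*; -‿distribʳ-*)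
  open GroupProperties +-group using (inverseˡ-unique)

  x*y≈0⇒x≈0 : ∀ {x y} → ¬ y ≈ 0# → x * y ≈ 0# → x ≈ 0#
  x*y≈0⇒x≈0 {x} {y} y≉0 xy≈0 with inverse y y≉0
  ... | y⁻¹ , yy⁻¹≈1 = begin
    x              ≈⟨ *-identityʳ x ⟨
    x * 1#         ≈⟨ *-cong refl yy⁻¹≈1 ⟨
    x * (y * y⁻¹)  ≈⟨ *-assoc x y y⁻¹ ⟨
    x * y * y⁻¹    ≈⟨ *-cong xy≈0 refl ⟩
    0# * y⁻¹       ≈⟨ zeroˡ y⁻¹ ⟩
    0#             ∎

  *-nonzero : ∀ {x y} → ¬ x ≈ 0# → ¬ y ≈ 0# → ¬ x * y ≈ 0#
  *-nonzero x≉0 y≉0 xy≈0 = x≉0 (x*y≈0⇒x≈0 y≉0 xy≈0)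

  inverse-nonzero : ∀ {x y} → x * y ≈ 1# → ¬ y ≈ 0#
  inverse-nonzero {x} xy≈1 y≈0 = 1≉0 (trans (sym xy≈1) (trans (*-cong refl y≈0) (zeroʳ x)))

  module _ (K : Carrier → Set ℓ) where
    open OnF K

    InSpan : ∀ {m} → Vec Carrier m → Carrier → Set (c ⊔ ℓ)
    InSpan vs x = ∃ λ cs → InK cs × x ≈ lincomb cs vs

    InSpan-resp-≈ : ∀ {m} (vs : Vec Carrier m) {x y} → x ≈ y → InSpan vs x → InSpan vs y
    InSpan-resp-≈ vs x≈y (cs , cs∈K , x≈) = cs , cs∈K , trans (sym x≈y) x≈

    InK-∷ : ∀ {m a} {cs : Vec Carrier m} → K a → InK cs → InK (a ∷ cs)
    InK-∷ a∈K cs∈K zero    = a∈K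
    InK-∷ a∈K cs∈K (suc j) = cs∈K j

    lincomb-replicate-0 : ∀ {m} (vs : Vec Carrier m) → lincomb (replicate m 0#) vs ≈ 0#
    lincomb-replicate-0 []       = refl
    lincomb-replicate-0 (v ∷ vs) = trans (+-cong (zeroˡ v) (lincomb-replicate-0 vs)) (+-identityˡ 0#)

    *-lincomb : ∀ {m} a (cs : Vec Carrier m) vs → a * lincomb cs vs ≈ lincomb (map (a *_) cs) vs
    *-lincomb a []       []       = zeroʳ a
    *-lincomb a (b ∷ cs) (v ∷ vs) = begin
      a * (b * v + lincomb cs vs)          ≈⟨ distribˡ a _ _ ⟩
      a * (b * v) + a * lincomb cs vs      ≈⟨ +-cong (sym (*-assoc a b v)) (*-lincomb a cs vs) ⟩
      a * b * v + lincomb (map (a *_) cs) vs ∎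

    lincomb-cong : ∀ {m} (cs ds : Vec Carrier m) vs → (∀ j → lookup cs j ≈ lookup ds j) →
      lincomb cs vs ≈ lincomb ds vs
    lincomb-cong []       []       []       _     = refl
    lincomb-cong (a ∷ cs) (b ∷ ds) (v ∷ vs) cs≈ds =
      +-cong (*-cong (cs≈ds zero) refl) (lincomb-cong cs ds vs (λ j → cs≈ds (suc j)))

    lincomb-∈ : ∀ {p} {W : Carrier → Set p} → IsSubspace W → ∀ {m} (cs : Vec Carrier m) vs →
      (∀ j → W (lookup vs j)) → InK cs → W (lincomb cs vs)
    lincomb-∈ (_ , 0∈W , _ , _) [] [] _ _ = 0∈W
    lincomb-∈ W@(_ , _ , +-closed , *-closed) (a ∷ cs) (v ∷ vs) vs∈W cs∈K =
      +-closed (*-closed (cs∈K zero) (vs∈W zero))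
               (lincomb-∈ W cs vs (λ j → vs∈W (suc j)) (λ j → cs∈K (suc j)))

    module V {r} = OnFr r K

    0ᵛ : ∀ {r} → Vecᶠ r
    0ᵛ _ = 0#

    lincombᵛ-at : ∀ {r m} (cs : Vec Carrier m) (ws : Vec (Vecᶠ r) m) l →
      V.lincomb cs ws l ≈ lincomb cs (map (λ w → w l) ws)
    lincombᵛ-at []       []       l = refl
    lincombᵛ-at (a ∷ cs) (w ∷ ws) l = +-cong refl (lincombᵛ-at cs ws l)

    lincombᵛ-0∷ : ∀ {r m} (ds : Vec Carrier m) (ws : Vec (Vecᶠ r) m) l →
      V.lincomb ds (map (0# Vector.∷_) ws) l ≈ (0# Vector.∷ V.lincomb ds ws) l
    lincombᵛ-0∷ []       []       zero    = refl
    lincombᵛ-0∷ []       []       (suc i) = refl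
    lincombᵛ-0∷ (a ∷ ds) (w ∷ ws) zero    =
      trans (+-cong (zeroʳ a) (lincombᵛ-0∷ ds ws zero)) (+-identityʳ 0#)
    lincombᵛ-0∷ (a ∷ ds) (w ∷ ws) (suc i) = +-cong refl (lincombᵛ-0∷ ds ws (suc i))

    lincombᵛ-++ : ∀ {r m n} (cs : Vec Carrier m) bs (ds : Vec Carrier n) (ws : Vec (Vecᶠ r) n) l →
      V.lincomb (cs ++ ds) (map (Vector._∷ 0ᵛ) bs ++ map (0# Vector.∷_) ws) l
        ≈ (lincomb cs bs Vector.∷ V.lincomb ds ws) l
    lincombᵛ-++ []       []       ds ws l = lincombᵛ-0∷ ds ws l
    lincombᵛ-++ (a ∷ cs) (b ∷ bs) ds ws zero    = +-cong refl (lincombᵛ-++ cs bs ds ws zero)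
    lincombᵛ-++ (a ∷ cs) (b ∷ bs) ds ws (suc i) = begin
      a * 0# + _                 ≈⟨ +-cong (zeroʳ a) (lincombᵛ-++ cs bs ds ws (suc i)) ⟩
      0# + V.lincomb ds ws i     ≈⟨ +-identityˡ _ ⟩
      V.lincomb ds ws i          ∎

    HasDim-prodSpace : ∀ {r} (U : Fin r → Carrier → Set (c ⊔ ℓ)) (k : Fin r → ℕ) →
      (∀ i → IsSubspace (U i)) → (∀ i → HasDim (U i) (k i)) →
      V.HasDim (prodSpace U) (sum (tabulate k))
    HasDim-prodSpace {zero} U k _ _ = [] , (λ ()) , (λ { [] _ _ () }) , λ _ _ → [] , (λ ()) , λ ()
    HasDim-prodSpace {suc r} U k sub dims
      with dims zero | HasDim-prodSpace (λ i → U (suc i)) (λ i → k (suc i)) (λ i → sub (suc i)) (λ i → dims (suc i))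
    ... | bs , bs∈U₀ , bs-indep , bs-span | ws , ws∈U′ , ws-indep , ws-span =
      basis , basis⊆U , basis-indep , basis-span
      where
      basis = map (Vector._∷ 0ᵛ) bs ++ map (0# Vector.∷_) ws
      0∈U : ∀ i → U i 0#
      0∈U i = proj₁ (proj₂ (sub i))
      basis⊆U : ∀ j → prodSpace U (lookup basis j)
      basis⊆U = ∀-++ (prodSpace U) (map (Vector._∷ 0ᵛ) bs) (map (0# Vector.∷_) ws)
        (∀-map (prodSpace U) (Vector._∷ 0ᵛ) bs λ j → λ { zero → bs∈U₀ j ; (suc i) → 0∈U (suc i) })
        (∀-map (prodSpace U) (0# Vector.∷_) ws λ j → λ { zero → 0∈U zero ; (suc i) → ws∈U′ j i })
      basis-indep : V.LinIndep basis
      basis-indep cs cs∈K lc≈0 with splitAt (k zero) cs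
      ... | cs₁ , cs₂ , ≡.refl = ∀-++ (_≈ 0#) cs₁ cs₂
        (bs-indep cs₁ (∀-++ˡ K cs₁ cs₂ cs∈K)
          (trans (sym (lincombᵛ-++ cs₁ bs cs₂ ws zero)) (lc≈0 zero)))
        (ws-indep cs₂ (∀-++ʳ K cs₁ cs₂ cs∈K)
          λ i → trans (sym (lincombᵛ-++ cs₁ bs cs₂ ws (suc i))) (lc≈0 (suc i)))
      basis-span : V.Spans (prodSpace U) basis
      basis-span w w∈U with bs-span (w zero) (w∈U zero) | ws-span (λ i → w (suc i)) (λ i → w∈U (suc i))
      ... | cs₁ , cs₁∈K , w₀≈ | cs₂ , cs₂∈K , w′≈ =
        cs₁ ++ cs₂ , ∀-++ K cs₁ cs₂ cs₁∈K cs₂∈K ,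
        λ l → trans (w≈ l) (sym (lincombᵛ-++ cs₁ bs cs₂ ws l))
        where
        w≈ : ∀ l → w l ≈ (lincomb cs₁ bs Vector.∷ V.lincomb cs₂ ws) l
        w≈ zero    = w₀≈
        w≈ (suc i) = w′≈ i

    e-diag : ∀ {r} (i : Fin r) → e i i ≈ 1#
    e-diag i with i ≟ i
    ... | yes _   = refl
    ... | no  i≢i = ⊥-elim (i≢i ≡.refl)

    lincombᵛ-map-* : ∀ {r m} (cs : Vec Carrier m) bs (w : Vecᶠ r) l →
      V.lincomb cs (map (λ b l → b * w l) bs) l ≈ lincomb cs bs * w l
    lincombᵛ-map-* []       []       w l = sym (zeroˡ (w l))
    lincombᵛ-map-* (a ∷ cs) (b ∷ bs) w l = begin
      a * (b * w l) + V.lincomb cs _ l      ≈⟨ +-cong (sym (*-assoc a b (w l))) (lincombᵛ-map-* cs bs w l) ⟩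
      a * b * w l + lincomb cs bs * w l     ≈⟨ distribʳ (w l) _ _ ⟨
      (a * b + lincomb cs bs) * w l         ∎

    Span-⊆ : ∀ {r} {v w : Vecᶠ r} β → (∀ l → w l ≈ β * v l) → V.Span w ⊆ V.Span v
    Span-⊆ {v = v} {w} β w≈βv (α , x≈αw) =
      α * β , λ l → trans (x≈αw l) (trans (*-cong refl (w≈βv l)) (sym (*-assoc α β (v l))))

    Span-lincomb : ∀ {r m} {v : Vecᶠ r} (ws : Vec (Vecᶠ r) m) → (∀ j → V.Span v (lookup ws j)) →
      ∀ cs → V.Span v (V.lincomb cs ws)
    Span-lincomb [] _ [] = 0# , λ l → sym (zeroˡ _)
    Span-lincomb {v = v} (w ∷ ws) ws⊆ (a ∷ cs) with ws⊆ zero | Span-lincomb ws (λ j → ws⊆ (suc j)) cs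
    ... | α , w≈αv | β , rest≈βv = a * α + β , λ l → begin
      a * w l + V.lincomb cs ws l    ≈⟨ +-cong (*-cong refl (w≈αv l)) (rest≈βv l) ⟩
      a * (α * v l) + β * v l        ≈⟨ +-cong (sym (*-assoc a α (v l))) refl ⟩
      a * α * v l + β * v l          ≈⟨ distribʳ (v l) _ _ ⟨
      (a * α + β) * v l              ∎

    Span-zero : ∀ {r} {v x : Vecᶠ r} {i} → V.Span v x → ¬ v i ≈ 0# → x i ≈ 0# → ∀ l → x l ≈ 0#
    Span-zero {v = v} {i = i} (α , x≈αv) vᵢ≉0 xᵢ≈0 l = begin
      _        ≈⟨ x≈αv l ⟩
      α * v l  ≈⟨ *-cong (x*y≈0⇒x≈0 vᵢ≉0 (trans (sym (x≈αv i)) xᵢ≈0)) refl ⟩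
      0# * v l ≈⟨ zeroˡ (v l) ⟩
      0#       ∎

    -- on the F-line spanned by v, the i-th coordinate is injective as soon as v i ≠ 0
    LinIndep-coordinate : ∀ {r m} {v : Vecᶠ r} {i} (ws : Vec (Vecᶠ r) m) →
      (∀ j → V.Span v (lookup ws j)) → ¬ v i ≈ 0# → V.LinIndep ws → LinIndep (map (λ w → w i) ws)
    LinIndep-coordinate {i = i} ws ws⊆ vᵢ≉0 ws-indep cs cs∈K lc≈0 = ws-indep cs cs∈K
      (Span-zero (Span-lincomb ws ws⊆ cs) vᵢ≉0 (trans (lincombᵛ-at cs ws i) lc≈0))

    Span-axis : ∀ {r} {v : Vecᶠ r} i → ¬ v i ≈ 0# → (∀ l → ¬ i ≡ l → v l ≈ 0#) →
      SameSet (λ x y → ∀ l → x l ≈ y l) (V.Span v) (V.Span (e i))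
    Span-axis {v = v} i vᵢ≉0 v≈0 x with inverse (v i) vᵢ≉0
    ... | y , vᵢy≈1 = Span-⊆ (v i) v≈vᵢe , Span-⊆ y e≈yv
      where
      v≈vᵢe : ∀ l → v l ≈ v i * e i l
      v≈vᵢe l with i ≟ l
      ... | yes ≡.refl = sym (*-identityʳ (v i))
      ... | no  i≢l    = trans (v≈0 l i≢l) (sym (zeroʳ (v i)))
      e≈yv : ∀ l → e i l ≈ y * v l
      e≈yv l = begin
        e i l               ≈⟨ *-identityˡ (e i l) ⟨
        1# * e i l          ≈⟨ *-cong (trans (sym vᵢy≈1) (*-comm (v i) y)) refl ⟩
        y * v i * e i l     ≈⟨ *-assoc y (v i) (e i l) ⟩
        y * (v i * e i l)   ≈⟨ *-cong refl (v≈vᵢe l) ⟨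
        y * v l             ∎

    module _ {r} (U : Fin r → Carrier → Set (c ⊔ ℓ)) (sub : ∀ i → IsSubspace (U i)) where
      private
        U-resp : ∀ i {x y} → x ≈ y → U i x → U i y
        U-resp i = proj₁ (sub i)

      *e∈prodSpace : ∀ i {b} → U i b → prodSpace U (λ l → b * e i l)
      *e∈prodSpace i {b} b∈U l with i ≟ l
      ... | yes ≡.refl = U-resp i (sym (*-identityʳ b)) b∈U
      ... | no  _      = U-resp l (sym (zeroʳ b)) (proj₁ (proj₂ (sub l)))

      HasDim-axis : ∀ i {d} → HasDim (U i) d → V.HasDim (prodSpace U ∩ V.Span (e i)) d
      HasDim-axis i (bs , bs∈U , bs-indep , bs-span) = basis , basis⊆ , basis-indep , basis-span
        where
        basis = map (λ b l → b * e i l) bs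
        basis⊆ : ∀ j → (prodSpace U ∩ V.Span (e i)) (lookup basis j)
        basis⊆ = ∀-map (prodSpace U ∩ V.Span (e i)) (λ b l → b * e i l) bs
          λ j → *e∈prodSpace i (bs∈U j) , lookup bs j , λ _ → refl
        basis-indep : V.LinIndep basis
        basis-indep cs cs∈K lc≈0 = bs-indep cs cs∈K (begin
          lincomb cs bs             ≈⟨ *-identityʳ _ ⟨
          lincomb cs bs * 1#        ≈⟨ *-cong refl (e-diag i) ⟨
          lincomb cs bs * e i i     ≈⟨ lincombᵛ-map-* cs bs (e i) i ⟨
          V.lincomb cs basis i      ≈⟨ lc≈0 i ⟩
          0#                        ∎)
        basis-span : V.Spans (prodSpace U ∩ V.Span (e i)) basis
        basis-span w (w∈U , α , w≈αe) with bs-span α (U-resp i w≈α (w∈U i))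
          where w≈α = trans (w≈αe i) (trans (*-cong refl (e-diag i)) (*-identityʳ α))
        ... | cs , cs∈K , α≈ = cs , cs∈K ,
          λ l → trans (w≈αe l) (trans (*-cong α≈ refl) (sym (lincombᵛ-map-* cs bs (e i) l)))

      coordinate∈U∩scale : ∀ {v w : Vecᶠ r} i j {y} → prodSpace U w → V.Span v w → v j * y ≈ 1# →
        (U i ∩ scale (v i * y) (U j)) (w i)
      coordinate∈U∩scale {v} {w} i j {y} w∈U (α , w≈αv) vⱼy≈1 = w∈U i , w j , w∈U j , (begin
        w i                           ≈⟨ w≈αv i ⟩
        α * v i                       ≈⟨ *-identityʳ _ ⟨
        α * v i * 1#                  ≈⟨ *-cong refl vⱼy≈1 ⟨
        α * v i * (v j * y)           ≈⟨ solve 4 (λ α a b y → (α ⊕ a) ⊕ (b ⊕ y) ⊜ (a ⊕ y) ⊕ (α ⊕ b))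
                                           refl α (v i) (v j) y ⟩
        v i * y * (α * v j)           ≈⟨ *-cong refl (w≈αv j) ⟨
        v i * y * w j                 ∎)
        where open import Algebra.Solver.CommutativeMonoid *-commutativeMonoid

    module _ (K-subfield : IsSubfield K) where
      private
        K-0 : K 0#
        K-0 = proj₁ (proj₂ K-subfield)
        K-1 : K 1#
        K-1 = proj₁ (proj₂ (proj₂ K-subfield))
        K-neg : ∀ {x} → K x → K (- x)
        K-neg = proj₁ (proj₂ (proj₂ (proj₂ (proj₂ K-subfield))))
        K-* : ∀ {x y} → K x → K y → K (x * y)
        K-* = proj₁ (proj₂ (proj₂ (proj₂ (proj₂ (proj₂ K-subfield)))))
        K-inverse : ∀ {x} → K x → ¬ x ≈ 0# → ∃ λ y → K y × x * y ≈ 1#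
        K-inverse = proj₂ (proj₂ (proj₂ (proj₂ (proj₂ (proj₂ K-subfield)))))

      InK-replicate-0 : ∀ m → InK (replicate m 0#)
      InK-replicate-0 m j = ≡.subst K (≡.sym (lookup-replicate j 0#)) K-0

      InK-map-* : ∀ {m a} (cs : Vec Carrier m) → K a → InK cs → InK (map (a *_) cs)
      InK-map-* (b ∷ cs) a∈K cs∈K zero    = K-* a∈K (cs∈K zero)
      InK-map-* (b ∷ cs) a∈K cs∈K (suc j) = InK-map-* cs a∈K (λ j → cs∈K (suc j)) j

      InSpan-here : ∀ {m} (vs : Vec Carrier m) x → InSpan (x ∷ vs) x
      InSpan-here {m} vs x = 1# ∷ replicate m 0# , InK-∷ K-1 (InK-replicate-0 m) ,
        sym (trans (+-cong (*-identityˡ x) (lincomb-replicate-0 vs)) (+-identityʳ x))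

      InSpan-there : ∀ {m} (vs : Vec Carrier m) x → InSpan vs ⊆ InSpan (x ∷ vs)
      InSpan-there vs x (cs , cs∈K , y≈) = 0# ∷ cs , InK-∷ K-0 cs∈K ,
        trans y≈ (trans (sym (+-identityˡ _)) (+-cong (sym (zeroˡ x)) refl))

      LinIndep-∷ : Decidable _≈_ → ∀ {m} (vs : Vec Carrier m) x →
        LinIndep vs → ¬ InSpan vs x → LinIndep (x ∷ vs)
      LinIndep-∷ _≈?_ vs x vs-indep x∉ (a ∷ cs) a∷cs∈K ax+L≈0 = λ
        { zero    → a≈0
        ; (suc j) → vs-indep cs (λ j → a∷cs∈K (suc j)) L≈0 j }
        where
        L = lincomb cs vs
        ax≈-L : a * x ≈ - L
        ax≈-L = inverseˡ-unique (a * x) L ax+L≈0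
        -- otherwise x = -a⁻¹ L would lie in the span of vs
        a≈0 : a ≈ 0#
        a≈0 with a ≈? 0#
        ... | yes a≈0 = a≈0
        ... | no  a≉0 with K-inverse (a∷cs∈K zero) a≉0
        ...   | y , y∈K , ay≈1 = ⊥-elim (x∉ (map ((- y) *_) cs ,
                InK-map-* cs (K-neg y∈K) (λ j → a∷cs∈K (suc j)) , (begin
          x                       ≈⟨ *-identityˡ x ⟨
          1# * x                  ≈⟨ *-cong (trans (sym ay≈1) (*-comm a y)) refl ⟩
          y * a * x               ≈⟨ *-assoc y a x ⟩
          y * (a * x)             ≈⟨ *-cong refl ax≈-L ⟩
          y * - L                 ≈⟨ -‿distribʳ-* y L ⟨
          - (y * L)               ≈⟨ -‿distribˡ-* y L ⟩
          - y * L                 ≈⟨ *-lincomb (- y) cs vs ⟩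
          lincomb (map ((- y) *_) cs) vs ∎)))
        L≈0 : L ≈ 0#
        L≈0 = begin
          L          ≈⟨ +-identityˡ L ⟨
          0# + L     ≈⟨ +-cong (trans (sym (zeroˡ x)) (*-cong (sym a≈0) refl)) refl ⟩
          a * x + L  ≈⟨ ax+L≈0 ⟩
          0#         ∎

      module _ {N q} (F-finite : HasCard _≈_ (λ _ → ⊤) N) (K-finite : HasCard _≈_ K q) where
        _≈?_ : Decidable _≈_
        _≈?_ = finite⇒≈-decidable setoid F-finite

        private
          enumF : Fin N → Carrier
          enumF = proj₁ F-finite
          enumF-surjective : ∀ x → ∃ λ i → x ≈ enumF i
          enumF-surjective x = proj₂ (proj₂ (proj₂ F-finite)) x tt
          enumK : Fin q → Carrier
          enumK = proj₁ K-finite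
          enumK-surjective : ∀ {x} → K x → ∃ λ i → x ≈ enumK i
          enumK-surjective = proj₂ (proj₂ (proj₂ K-finite)) _

        InK-map-enumK : ∀ {m} (ds : Vec (Fin q) m) → InK (map enumK ds)
        InK-map-enumK ds j =
          ≡.subst K (≡.sym (lookup-map j enumK ds)) (proj₁ (proj₂ K-finite) (lookup ds j))

        enumK-coefficients : ∀ {m} (cs : Vec Carrier m) → InK cs →
          ∃ λ ds → ∀ j → lookup cs j ≈ lookup (map enumK ds) j
        enumK-coefficients []       _     = [] , λ ()
        enumK-coefficients (a ∷ cs) cs∈K
          with enumK-surjective (cs∈K zero) | enumK-coefficients cs (λ j → cs∈K (suc j))
        ... | d , a≈ | ds , cs≈ = d ∷ ds , λ { zero → a≈ ; (suc j) → cs≈ j }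

        InSpan? : ∀ {m} (vs : Vec Carrier m) x → Dec (InSpan vs x)
        InSpan? {m} vs x = map′
          (λ (ds , x≈) → map enumK ds , InK-map-enumK ds , x≈)
          (λ (cs , cs∈K , x≈) → let (ds , cs≈ds) = enumK-coefficients cs cs∈K in
             ds , trans x≈ (lincomb-cong cs (map enumK ds) vs cs≈ds))
          (any-Vec? m λ ds → x ≈? lincomb (map enumK ds) vs)

        module _ {p} (I : Carrier → Set p) where
          record IndependentIn (m : ℕ) : Set (c ⊔ ℓ ⊔ p) where
            field
              {size}      : ℕ
              family      : Vec Carrier size
              m≤size      : m ≤ size
              family⊆I    : ∀ j → I (lookup family j)
              independent : LinIndep family

          open IndependentIn

          module _ (I? : ∀ x → Dec (I x)) where
            insert : ∀ {m} x (s : IndependentIn m) → Σ (IndependentIn m) λ s′ →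
              InSpan (family s) ⊆ InSpan (family s′) × (I x → InSpan (family s′) x)
            insert x s with I? x | InSpan? (family s) x
            ... | no  x∉I | _        = s , id , λ x∈I → ⊥-elim (x∉I x∈I)
            ... | yes _   | yes x∈   = s , id , λ _ → x∈
            ... | yes x∈I | no  x∉   = s′ , InSpan-there (family s) x , λ _ → InSpan-here (family s) x
              where
              s′ = record
                { family      = x ∷ family s
                ; m≤size      = ≤-trans (m≤size s) (n≤1+n _)
                ; family⊆I    = λ { zero → x∈I ; (suc j) → family⊆I s j }
                ; independent = LinIndep-∷ _≈?_ (family s) x (independent s) x∉
                }

            absorb : ∀ {m} (xs : List Carrier) (s : IndependentIn m) → Σ (IndependentIn m) λ s′ →
              ∀ {x} → x ∈ xs → I x → InSpan (family s′) x
            absorb List.[] s = s , λ ()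
            absorb (x List.∷ xs) s with absorb xs s
            ... | s₁ , covers-xs with insert x s₁
            ...   | s₂ , s₁⊆s₂ , covers-x = s₂ , λ
                      { (here ≡.refl) x∈I → covers-x x∈I
                      ; (there y∈xs) y∈I → s₁⊆s₂ (covers-xs y∈xs y∈I) }

            extend-to-basis : (∀ {x y} → x ≈ y → I x → I y) → ∀ {m} → IndependentIn m →
              ∃ λ d → HasDim I d × m ≤ d
            extend-to-basis I-resp s with absorb (List.tabulate enumF) s
            ... | s′ , covers = size s′ , (family s′ , family⊆I s′ , independent s′ , spans) , m≤size s′
              where
              spans : Spans I (family s′)
              spans w w∈I with enumF-surjective w
              ... | i , w≈ = InSpan-resp-≈ (family s′) (sym w≈)
                               (covers (∈-tabulate⁺ i) (I-resp w≈ w∈I))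

        Subspace? : ∀ {p} {W : Carrier → Set p} {d} → IsSubspace W → HasDim W d → ∀ x → Dec (W x)
        Subspace? W (bs , bs∈W , _ , bs-span) x = map′
          (λ (cs , cs∈K , x≈) → proj₁ W (sym x≈) (lincomb-∈ W cs bs bs∈W cs∈K))
          (bs-span x) (InSpan? bs x)

        scale? : ∀ {W : Carrier → Set (c ⊔ ℓ)} → (∀ {x y} → x ≈ y → W x → W y) → (∀ x → Dec (W x)) →
          ∀ γ x → Dec (scale γ W x)
        scale? W-resp W? γ x = map′
          (λ (i , fᵢ∈W , x≈) → enumF i , fᵢ∈W , x≈)
          (λ (u , u∈W , x≈γu) → let (i , u≈fᵢ) = enumF-surjective u in
             i , W-resp u≈fᵢ u∈W , trans x≈γu (*-cong refl u≈fᵢ))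
          (any? λ i → W? (enumF i) ×-dec (x ≈? (γ * enumF i)))

        module _ {r n q′} (U : Fin r → Carrier → Set (c ⊔ ℓ)) {k : Fin r → ℕ}
                 (sub : ∀ i → IsSubspace (U i)) (dims : ∀ i → HasDim (U i) (k i))
                 (MS : MultiSidon q′ n r K U) where
          open MultiSidon MS

          private
            U-resp : ∀ i {x y} → x ≈ y → U i x → U i y
            U-resp i = proj₁ (sub i)

          two-supports⇒weight≤1 : ∀ {v : Vecᶠ r} {i j d} → ¬ i ≡ j → ¬ v i ≈ 0# → ¬ v j ≈ 0# →
            V.HasDim (prodSpace U ∩ V.Span v) d → d ≤ 1
          two-supports⇒weight≤1 {v} {i} {j} i≢j vᵢ≉0 vⱼ≉0 (ws , ws∈ , ws-indep , _)
            with inverse (v j) vⱼ≉0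
          ... | y , vⱼy≈1 with extend-to-basis I I? I-resp coordinates
            where
            I = U i ∩ scale (v i * y) (U j)
            I? : ∀ x → Dec (I x)
            I? x = Subspace? (sub i) (dims i) x ×-dec scale? (U-resp j) (Subspace? (sub j) (dims j)) (v i * y) x
            I-resp : ∀ {x x′} → x ≈ x′ → I x → I x′
            I-resp x≈x′ (x∈Uᵢ , u , u∈Uⱼ , x≈γu) = U-resp i x≈x′ x∈Uᵢ , u , u∈Uⱼ , trans (sym x≈x′) x≈γu
            coordinates : IndependentIn I _
            coordinates = record
              { family      = map (λ w → w i) ws
              ; m≤size      = ≤-refl
              ; family⊆I    = ∀-map I (λ w → w i) ws λ l →
                  coordinate∈U∩scale U sub i j (proj₁ (ws∈ l)) (proj₂ (ws∈ l)) vⱼy≈1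
              ; independent = LinIndep-coordinate ws (λ l → proj₂ (ws∈ l)) vᵢ≉0 ws-indep
              }
          ... | d′ , I-dim , d≤d′ = ≤-trans d≤d′ (sidon (v i * y) i j Uᵢ≢γUⱼ d′ I-dim)
            where
            Uᵢ≢γUⱼ : ¬ SameSetF (U i) (scale (v i * y) (U j))
            Uᵢ≢γUⱼ Uᵢ≡γUⱼ = orb-disjoint i j i≢j
              (1# , v i * y , 1≉0 , *-nonzero vᵢ≉0 (inverse-nonzero vⱼy≈1) , λ x →
                (λ (u , u∈Uᵢ , x≈1u) → proj₁ (Uᵢ≡γUⱼ x) (U-resp i (trans (sym (*-identityˡ u)) (sym x≈1u)) u∈Uᵢ)) ,
                (λ x∈γUⱼ → x , proj₂ (Uᵢ≡γUⱼ x) x∈γUⱼ , sym (*-identityˡ x)))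

          weight>1⇒axis : ∀ (v : Vecᶠ r) → ¬ (∀ l → v l ≈ 0#) → ∀ d →
            V.HasDim (prodSpace U ∩ V.Span v) d → 1 < d →
            ∃ λ i → SameSet (λ x y → ∀ l → x l ≈ y l) (V.Span v) (V.Span (e i))
          weight>1⇒axis v v≉0 d dim 1<d with any? (λ i → ¬? (v i ≈? 0#))
          ... | no  v≈0 = ⊥-elim (v≉0 λ l → decidable-stable (v l ≈? 0#) λ vₗ≉0 → v≈0 (l , vₗ≉0))
          ... | yes (i , vᵢ≉0) with any? (λ j → ¬? (i ≟ j) ×-dec ¬? (v j ≈? 0#))
          ...   | yes (j , i≢j , vⱼ≉0) = ⊥-elim (<⇒≱ 1<d (two-supports⇒weight≤1 i≢j vᵢ≉0 vⱼ≉0 dim))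
          ...   | no  no-other = i , Span-axis i vᵢ≉0 λ l i≢l →
                    decidable-stable (v l ≈? 0#) λ vₗ≉0 → no-other (l , i≢l , vₗ≉0)

proposition7p6 : ∀ {c ℓ} (F : FieldD c ℓ) → let open OverField F in
    (q n r : ℕ) → IsPrimePower q → 1 ≤ n → 1 ≤ r →
    HasCard _≈_ (λ _ → ⊤) (q ^ n) →
    (K : Carrier → Set ℓ) → IsSubfield K → HasCard _≈_ K q →
    (U : Fin r → Carrier → Set (c ⊔ ℓ)) → (k : Fin r → ℕ) →
    (∀ i → OnF.IsSubspace K (U i)) →
    (∀ i → OnF.HasDim K (U i) (k i)) →
    MultiSidon q n r K U →
      OnFr.HasDim r K (prodSpace U) (sum (tabulate k))
    × (∀ (v : Vecᶠ r) → ¬ (∀ j → v j ≈ 0#) → ∀ d →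
         OnFr.HasDim r K (prodSpace U ∩ OnFr.Span r K v) d → 1 < d →
         ∃ λ i → SameSet (λ x y → ∀ j → x j ≈ y j)
                   (OnFr.Span r K v) (OnFr.Span r K (e i)))
    × (∀ i → ∃ λ d → OnFr.HasDim r K (prodSpace U ∩ OnFr.Span r K (e i)) d × 1 < d)
proposition7p6 F q n r _ _ _ F-finite K K-subfield K-finite U k sub dims MS =
    HasDim-prodSpace F K U k sub dims
  , weight>1⇒axis F K K-subfield F-finite K-finite U sub dims MS
  , λ i → let (d , Uᵢ-dim , 2≤d) = OverField.MultiSidon.dim≥2 MS i in d , HasDim-axis F K U sub i Uᵢ-dim , 2≤d
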